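{- There exist absolute constants $c_1>0$ and $c_2$ such that \[ c_1\frac{q^n}{n}\leq C(n,q)\leq c_2\frac{q^n}{n} \] for all integers $n\geq 2$ and $q\geq 2$.
   Context: Let $F$ be a finite alphabet with $|F|=q$. Two words $u,v\in F^n$ (not necessarily distinct) are overlapping if a non-empty proper prefix of $u$ equals a non-empty proper suffix of $v$, or a non-empty proper prefix of $v$ equals a non-empty proper suffix of $u$. A code $C\subseteq F^n$ is non-overlapping if for all (not necessarily distinct) $u,v\in C$, the words $u$ and $v$ are not overlapping. $C(n,q)$ denotes the maximum cardinality of a non-overlapping code $C\subseteq F^n$ with $|F|=q$. -}

module Defs where

open import Data.Nat using (ℕ; zero; suc; _∸_; _≤_; _<_)
open import Data.Fin using (Fin)
open import Data.Vec using (Vec; toList)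
open import Data.List using (List; take; drop; length)
open import Data.List.Membership.Propositional using (_∈_)
open import Data.List.Relation.Unary.Unique.Propositional using (Unique)
open import Data.Product using (Σ; ∃; _×_; _,_)
open import Data.Sum using (_⊎_)
open import Data.Integer using (+_)
open import Data.Rational using (ℚ; _/_)
open import Relation.Binary.PropositionalEquality using (_≡_)
open import Relation.Nullary using (¬_)

Word : ℕ → ℕ → Set
Word n q = Vec (Fin q) n

PrefixIsSuffix : ∀ {n q} → ℕ → Word n q → Word n q → Set
PrefixIsSuffix {n} k u v = take k (toList u) ≡ drop (n ∸ k) (toList v)

Overlapping : ∀ {n q} → Word n q → Word n q → Set
Overlapping {n} u v =
  ∃ λ k → 1 ≤ k × k < n × (PrefixIsSuffix k u v ⊎ PrefixIsSuffix k v u)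

record Code (n q : ℕ) : Set where
  constructor code
  field
    words  : List (Word n q)
    unique : Unique words

open Code public

card : ∀ {n q} → Code n q → ℕ
card C = length (words C)

NonOverlapping : ∀ {n q} → Code n q → Set
NonOverlapping C = ∀ u v → u ∈ words C → v ∈ words C → ¬ Overlapping u v

ℕtoℚ : ℕ → ℚ
ℕtoℚ k = + k / 1

module Submission where

-- Upper bound: the n cyclic rotations of the words of a non-overlapping code are pairwise
-- distinct words of length n, since two coinciding rotations of codewords u, v are either the
-- same rotation of the same word or exhibit a prefix of u that is a suffix of v.  Hence
-- n · |C| ≤ q^n.
--
-- Lower bound: call the z = ⌊q/2⌋ letters a < z small and the other q − z ≥ q/2 letters large,
-- and take the words that start with k small letters followed by a large one, end with a large
-- letter, and contain no further block of k small letters.  A prefix of u of length j that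
-- were a suffix of v would place k small letters at position n − j ≥ 1 of v (a block cut short
-- by the end of v when j ≤ k), which is impossible.  Counting with the first two terms of
-- inclusion–exclusion, the code has at least z^k (q−z)² q^(n−k−2) − (n−2k−1) z^(2k) q^(n−2k)
-- words, and taking k least with 8(n−2k−1) z^k ≤ q^k, so that also q^k ≤ 24 n z^k, this is at
-- least q^n / (192 n).

open import Data.Bool using (Bool; true; false; not; _∧_; T)
open import Data.Bool.ListAction using (any)
open import Data.Bool.Properties using (T-∧)
open import Data.Fin as Fin using (Fin; toℕ)
import Data.Integer as ℤ
import Data.Integer.Properties as ℤₚ
open import Data.List using (List; []; _∷_; _++_; [_]; map; take; drop; length; upTo; allFin; tabulate; replicate; filter; cartesianProductWith; cartesianProduct)
open import Data.List.Properties
open import Data.List.Membership.Propositional using (_∈_; lose)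
open import Data.List.Membership.Propositional.Properties
open import Data.List.Relation.Binary.Subset.Propositional using (_⊆_)
open import Data.List.Relation.Unary.All as All using (All; []; _∷_)
import Data.List.Relation.Unary.All.Properties as Allₚ
open import Data.List.Relation.Unary.Any using (here; there)
open import Data.List.Relation.Unary.Any.Properties using (any⁺)
open import Data.List.Relation.Unary.Unique.Propositional using (Unique; []; _∷_)
import Data.List.Relation.Unary.Unique.Propositional.Properties as Uniqueₚ
open import Data.Nat using (ℕ; zero; suc; _+_; _*_; _∸_; _^_; _≤_; _<_; _≤?_; _⊓_; _<ᵇ_; ⌊_/2⌋; ⌈_/2⌉; NonZero; >-nonZero; z≤n; s≤s; z<s)
open import Data.Nat.Coprimality as Coprimality using (1-coprimeTo)
open import Data.Nat.ListAction using (product)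
open import Data.Nat.ListAction.Properties using (product-++)
open import Data.Nat.Properties
open import Data.Nat.Tactic.RingSolver using (solve-∀)
open import Data.Product using (Σ; ∃; ∃₂; _×_; _,_; proj₁; proj₂; map₁; map₂)
open import Data.Rational as ℚ using (ℚ; 0ℚ; 1ℚ)
import Data.Rational.Properties as ℚₚ
open import Data.Sum using (_⊎_; inj₁; inj₂)
open import Data.Vec using (Vec; []; _∷_; toList; fromList)
import Data.Vec.Properties as Vecₚ
open import Data.Vec.Relation.Binary.Equality.Cast using (cast-is-id)
open import Function using (_∘_)
open import Function.Bundles using (Equivalence)
open import Relation.Binary.PropositionalEquality hiding ([_])
open import Relation.Nullary using (¬_; Dec; contradiction; yes; no)
open import Relation.Nullary.Decidable using (T?)

open import Defs

module _ {A : Set} where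

  Unique⇒length≤ : ∀ {xs ys : List A} → Unique xs → xs ⊆ ys → length xs ≤ length ys
  Unique⇒length≤ {[]} _ _ = z≤n
  Unique⇒length≤ {x ∷ xs} (x∉xs ∷ xs!) x∷xs⊆ys
    with ys₁ , ys₂ , refl ← ∈-∃++ (x∷xs⊆ys (here refl)) = begin
      suc (length xs)                  ≤⟨ s≤s (Unique⇒length≤ xs! xs⊆ys₁++ys₂) ⟩
      suc (length (ys₁ ++ ys₂))        ≡⟨ cong suc (length-++ ys₁) ⟩
      suc (length ys₁ + length ys₂)    ≡⟨ +-suc (length ys₁) _ ⟨
      length ys₁ + length (x ∷ ys₂)    ≡⟨ length-++ ys₁ ⟨
      length (ys₁ ++ x ∷ ys₂)          ∎
    where
    open ≤-Reasoning
    xs⊆ys₁++ys₂ : xs ⊆ ys₁ ++ ys₂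
    xs⊆ys₁++ys₂ {y} y∈xs with ∈-++⁻ ys₁ (x∷xs⊆ys (there y∈xs))
    ... | inj₁ y∈ys₁ = ∈-++⁺ˡ y∈ys₁
    ... | inj₂ (here refl) = contradiction refl (All.lookup x∉xs y∈xs)
    ... | inj₂ (there y∈ys₂) = ∈-++⁺ʳ ys₁ y∈ys₂

  split-++ : ∀ (as bs cs ds : List A) → length cs ≤ length as → as ++ bs ≡ cs ++ ds →
             ∃ λ ms → as ≡ cs ++ ms × ds ≡ ms ++ bs
  split-++ as       bs []       ds _         eq = as , refl , sym eq
  split-++ (a ∷ as) bs (c ∷ cs) ds (s≤s |cs|≤|as|) eq
    with refl , eq′ ← ∷-injective eq
    with ms , refl , refl ← split-++ as bs cs ds |cs|≤|as| eq′ = ms , refl , refl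

  length-replicate-++ : ∀ m {x : A} {xs n} → length xs ≡ n → length (replicate m x ++ xs) ≡ m + n
  length-replicate-++ zero    |xs|≡n = |xs|≡n
  length-replicate-++ (suc m) |xs|≡n = cong suc (length-replicate-++ m |xs|≡n)

  take-length-++ : ∀ (xs ys : List A) → take (length xs) (xs ++ ys) ≡ xs
  take-length-++ []       ys = refl
  take-length-++ (x ∷ xs) ys = cong (x ∷_) (take-length-++ xs ys)

  drop-length-++ : ∀ (xs ys : List A) → drop (length xs) (xs ++ ys) ≡ ys
  drop-length-++ []       ys = refl
  drop-length-++ (x ∷ xs) ys = drop-length-++ xs ys

  length-take-≤ : ∀ i (l : List A) → i ≤ length l → length (take i l) ≡ i
  length-take-≤ i l i≤ = trans (length-take i l) (m≤n⇒m⊓n≡m i≤)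

module _ {A B : Set} (f : A → B) where

  Unique-map⁺-∈ : ∀ {xs} → (∀ {x y} → x ∈ xs → y ∈ xs → f x ≡ f y → x ≡ y) →
                  Unique xs → Unique (map f xs)
  Unique-map⁺-∈ {[]}     _   []          = []
  Unique-map⁺-∈ {x ∷ xs} inj (x∉xs ∷ xs!) =
    All.tabulate fx∉ ∷ Unique-map⁺-∈ (λ x∈ y∈ → inj (there x∈) (there y∈)) xs!
    where
    fx∉ : ∀ {w} → w ∈ map f xs → ¬ f x ≡ w
    fx∉ w∈ fx≡w with y , y∈xs , refl ← ∈-map⁻ f w∈ =
      All.lookup x∉xs y∈xs (inj (here refl) (there y∈xs) fx≡w)

length-cartesianProductWith : ∀ {A B C : Set} (f : A → B → C) (xs : List A) (ys : List B) →
  length (cartesianProductWith f xs ys) ≡ length xs * length ys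
length-cartesianProductWith f []       ys = refl
length-cartesianProductWith f (x ∷ xs) ys = begin
  length (map (f x) ys ++ cartesianProductWith f xs ys) ≡⟨ length-++ (map (f x) ys) ⟩
  length (map (f x) ys) + length (cartesianProductWith f xs ys)
    ≡⟨ cong₂ _+_ (length-map (f x) ys) (length-cartesianProductWith f xs ys) ⟩
  length ys + length xs * length ys ∎
  where open ≡-Reasoning

toList-injective : ∀ {A : Set} {n} (xs ys : Vec A n) → toList xs ≡ toList ys → xs ≡ ys
toList-injective xs ys eq = trans (sym (cast-is-id refl xs)) (Vecₚ.toList-injective refl xs ys eq)

module _ {A : Set} {P : A → Set} where

  All-take⇒at : ∀ m xs {b ys} → length xs < m → All P (take m (xs ++ b ∷ ys)) → P b
  All-take⇒at (suc m) []       _          (Pb ∷ _)  = Pb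
  All-take⇒at (suc m) (x ∷ xs) (s≤s |xs|<m) (_ ∷ Pxs) = All-take⇒at m xs |xs|<m Pxs

  All-take-drop⇒at : ∀ m s xs {b ys} → s ≤ length xs → length xs < s + m →
                     All P (take m (drop s (xs ++ b ∷ ys))) → P b
  All-take-drop⇒at m zero    xs       _          |xs|<m  = All-take⇒at m xs |xs|<m
  All-take-drop⇒at m (suc s) (x ∷ xs) (s≤s s≤|xs|) (s≤s |xs|<s+m) = All-take-drop⇒at m s xs s≤|xs| |xs|<s+m

-- Words, rotations and the upper bound

module _ {q : ℕ} where

  allWords : ∀ n → List (Word n q)
  allWords zero    = [ [] ]
  allWords (suc n) = cartesianProductWith _∷_ (allFin q) (allWords n)

  allWords-unique : ∀ n → Unique (allWords n)
  allWords-unique zero    = [] ∷ []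
  allWords-unique (suc n) =
    Uniqueₚ.cartesianProductWith⁺ _∷_ Vecₚ.∷-injective (Uniqueₚ.allFin⁺ q) (allWords-unique n)

  ∈-allWords : ∀ {n} (w : Word n q) → w ∈ allWords n
  ∈-allWords []      = here refl
  ∈-allWords (a ∷ w) = ∈-cartesianProductWith⁺ _∷_ (∈-allFin a) (∈-allWords w)

  length-allWords : ∀ n → length (allWords n) ≡ q ^ n
  length-allWords zero    = refl
  length-allWords (suc n) = begin
    length (cartesianProductWith _∷_ (allFin q) (allWords n)) ≡⟨ length-cartesianProductWith _∷_ (allFin q) (allWords n) ⟩
    length (allFin q) * length (allWords n)                   ≡⟨ cong₂ _*_ (length-tabulate {n = q} (λ a → a)) (length-allWords n) ⟩
    q * q ^ n                                                 ∎
    where open ≡-Reasoning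

  ∈-map-toList-allWords : ∀ {n} (l : List (Fin q)) → length l ≡ n → l ∈ map toList (allWords n)
  ∈-map-toList-allWords l refl =
    subst (_∈ map toList (allWords (length l))) (Vecₚ.toList∘fromList l) (∈-map⁺ toList (∈-allWords (fromList l)))

module _ {A : Set} where

  rotate : ℕ → List A → List A
  rotate i l = drop i l ++ take i l

  length-rotate : ∀ i (l : List A) → length (rotate i l) ≡ length l
  length-rotate i l = begin
    length (drop i l ++ take i l)          ≡⟨ length-++ (drop i l) ⟩
    length (drop i l) + length (take i l)  ≡⟨ +-comm (length (drop i l)) _ ⟩
    length (take i l) + length (drop i l)  ≡⟨ length-++ (take i l) ⟨
    length (take i l ++ drop i l)          ≡⟨ cong length (take++drop≡id i l) ⟩
    length l                               ∎
    where open ≡-Reasoning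

  swap-collision : ∀ a b a′ b′ → length a′ ≤ length a → a ++ b ≡ a′ ++ b′ →
                   (a ≡ a′ × b ≡ b′) ⊎ Σ A λ m → ∃ λ ms → b ++ a ≡ (b ++ a′) ++ m ∷ ms × b′ ++ a′ ≡ (m ∷ ms) ++ b ++ a′
  swap-collision a b a′ b′ |a′|≤|a| eq with split-++ a b a′ b′ |a′|≤|a| eq
  ... | []     , refl , refl = inj₁ (++-identityʳ a′ , refl)
  ... | m ∷ ms , refl , refl = inj₂ (m , ms , sym (++-assoc b a′ (m ∷ ms)) , ++-assoc (m ∷ ms) b a′)

  rotate-collision : ∀ {n i j} (u v : List A) → length u ≡ n → length v ≡ n → i ≤ j → j < n →
                     rotate i u ≡ rotate j v →
                     (i ≡ j × u ≡ v) ⊎ ∃ λ k → 1 ≤ k × k < n × take k u ≡ drop (n ∸ k) v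
  rotate-collision {n} {i} {j} u v |u|≡n |v|≡n i≤j j<n eq
    with swap-collision (drop i u) (take i u) (drop j v) (take j v) |drop-j-v|≤|drop-i-u| eq
    where
    |drop-j-v|≤|drop-i-u| : length (drop j v) ≤ length (drop i u)
    |drop-j-v|≤|drop-i-u| rewrite length-drop j v | length-drop i u | |u|≡n | |v|≡n = ∸-monoʳ-≤ n i≤j
  ... | inj₁ (drops≡ , takes≡) = inj₁ (i≡j , u≡v)
    where
    i≡j : i ≡ j
    i≡j = begin
      i                  ≡⟨ length-take-≤ i u (subst (i ≤_) (sym |u|≡n) (≤-trans i≤j (<⇒≤ j<n))) ⟨
      length (take i u)  ≡⟨ cong length takes≡ ⟩
      length (take j v)  ≡⟨ length-take-≤ j v (subst (j ≤_) (sym |v|≡n) (<⇒≤ j<n)) ⟩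
      j                  ∎
      where open ≡-Reasoning
    u≡v : u ≡ v
    u≡v = begin
      u                     ≡⟨ take++drop≡id i u ⟨
      take i u ++ drop i u  ≡⟨ cong₂ _++_ takes≡ drops≡ ⟩
      take j v ++ drop j v  ≡⟨ take++drop≡id j v ⟩
      v                     ∎
      where open ≡-Reasoning
  ... | inj₂ (m , ms , u≡p++m∷ms , v≡m∷ms++p) = inj₂ (length p , 1≤|p| , |p|<n , prefix≡suffix)
    where
    open ≡-Reasoning
    p : List A
    p = take i u ++ drop j v
    n≡|m∷ms|+|p| : n ≡ length (m ∷ ms) + length p
    n≡|m∷ms|+|p| = begin
      n                                ≡⟨ |v|≡n ⟨
      length v                         ≡⟨ cong length (take++drop≡id j v) ⟨
      length (take j v ++ drop j v)    ≡⟨ cong length v≡m∷ms++p ⟩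
      length ((m ∷ ms) ++ p)           ≡⟨ length-++ (m ∷ ms) ⟩
      length (m ∷ ms) + length p       ∎
    1≤|p| : 1 ≤ length p
    1≤|p| = ≤-trans (subst (1 ≤_) (sym |drop-j-v|) (m<n⇒0<n∸m j<n))
                    (subst (length (drop j v) ≤_) (sym (length-++ (take i u))) (m≤n+m _ (length (take i u))))
      where
      |drop-j-v| : length (drop j v) ≡ n ∸ j
      |drop-j-v| = trans (length-drop j v) (cong (_∸ j) |v|≡n)
    |p|<n : length p < n
    |p|<n = subst (length p <_) (sym n≡|m∷ms|+|p|) (m<n+m (length p) z<s)
    prefix≡suffix : take (length p) u ≡ drop (n ∸ length p) v
    prefix≡suffix = begin
      take (length p) u                        ≡⟨ cong (take (length p)) (take++drop≡id i u) ⟨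
      take (length p) (take i u ++ drop i u)   ≡⟨ cong (take (length p)) u≡p++m∷ms ⟩
      take (length p) (p ++ m ∷ ms)            ≡⟨ take-length-++ p (m ∷ ms) ⟩
      p                                        ≡⟨ drop-length-++ (m ∷ ms) p ⟨
      drop (length (m ∷ ms)) ((m ∷ ms) ++ p)   ≡⟨ cong₂ drop n∸|p|≡|m∷ms| v≡m∷ms++p ⟨
      drop (n ∸ length p) (take j v ++ drop j v) ≡⟨ cong (drop (n ∸ length p)) (take++drop≡id j v) ⟩
      drop (n ∸ length p) v                    ∎
      where
      n∸|p|≡|m∷ms| : n ∸ length p ≡ length (m ∷ ms)
      n∸|p|≡|m∷ms| = trans (cong (_∸ length p) n≡|m∷ms|+|p|) (m+n∸n≡m (length (m ∷ ms)) (length p))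

n*card≤q^n : ∀ {n q} (C : Code n q) → NonOverlapping C → n * card C ≤ q ^ n
n*card≤q^n {n} {q} C nonOverlapping = begin
  n * card C                      ≡⟨ *-comm n (card C) ⟩
  card C * n                      ≡⟨ cong (card C *_) (length-upTo n) ⟨
  card C * length (upTo n)        ≡⟨ length-cartesianProductWith _,_ (words C) (upTo n) ⟨
  length shifts                   ≡⟨ length-map rotation shifts ⟨
  length rotations                ≤⟨ Unique⇒length≤ rotations-unique rotations⊆words ⟩
  length (map toList (allWords n)) ≡⟨ length-map toList (allWords n) ⟩
  length (allWords n)             ≡⟨ length-allWords n ⟩
  q ^ n                           ∎
  where
  open ≤-Reasoning
  shifts : List (Word n q × ℕ)
  shifts = cartesianProduct (words C) (upTo n)
  rotation : Word n q × ℕ → List (Fin q)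
  rotation (c , i) = rotate i (toList c)
  rotations : List (List (Fin q))
  rotations = map rotation shifts
  rotations⊆words : rotations ⊆ map toList (allWords n)
  rotations⊆words r∈ with (c , i) , _ , refl ← ∈-map⁻ rotation r∈ =
    ∈-map-toList-allWords _ (trans (length-rotate i (toList c)) (Vecₚ.length-toList c))
  rotation-injective-≤ : ∀ {c c′ i i′} → (c , i) ∈ shifts → (c′ , i′) ∈ shifts → i ≤ i′ →
                         rotation (c , i) ≡ rotation (c′ , i′) → (c , i) ≡ (c′ , i′)
  rotation-injective-≤ {c} {c′} {i} x∈ y∈ i≤i′ eq
    with c∈ , _ ← ∈-cartesianProduct⁻ (words C) (upTo n) x∈
    with c′∈ , i′∈ ← ∈-cartesianProduct⁻ (words C) (upTo n) y∈
    with rotate-collision (toList c) (toList c′) (Vecₚ.length-toList c) (Vecₚ.length-toList c′) i≤i′ (∈-upTo⁻ i′∈) eq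
  ... | inj₁ (refl , c≡c′) = cong (_, i) (toList-injective c c′ c≡c′)
  ... | inj₂ (k , 1≤k , k<n , prefix≡suffix) =
    contradiction (k , 1≤k , k<n , inj₁ prefix≡suffix) (nonOverlapping c c′ c∈ c′∈)
  rotation-injective : ∀ {x y} → x ∈ shifts → y ∈ shifts → rotation x ≡ rotation y → x ≡ y
  rotation-injective {_ , i} {_ , i′} x∈ y∈ eq with ≤-total i i′
  ... | inj₁ i≤i′ = rotation-injective-≤ x∈ y∈ i≤i′ eq
  ... | inj₂ i′≤i = sym (rotation-injective-≤ y∈ x∈ i′≤i (sym eq))
  rotations-unique : Unique rotations
  rotations-unique = Unique-map⁺-∈ rotation rotation-injective (Uniqueₚ.cartesianProduct⁺ (unique C) (Uniqueₚ.upTo⁺ n))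

-- Counting words by sums of indicators

𝟙 : Bool → ℕ
𝟙 true  = 1
𝟙 false = 0

∑ : ∀ {A : Set} → List A → (A → ℕ) → ℕ
∑ []       f = 0
∑ (x ∷ xs) f = f x + ∑ xs f

syntax ∑ xs (λ x → e) = ∑[ x ∈ xs ] e

module _ {A : Set} where

  ∑-++ : ∀ xs ys (f : A → ℕ) → ∑ (xs ++ ys) f ≡ ∑ xs f + ∑ ys f
  ∑-++ []       ys f = refl
  ∑-++ (x ∷ xs) ys f = trans (cong (f x +_) (∑-++ xs ys f)) (sym (+-assoc (f x) _ _))

  ∑-cong : ∀ xs {f g : A → ℕ} → (∀ x → f x ≡ g x) → ∑ xs f ≡ ∑ xs g
  ∑-cong []       f≗g = refl
  ∑-cong (x ∷ xs) f≗g = cong₂ _+_ (f≗g x) (∑-cong xs f≗g)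

  ∑-mono-≤ : ∀ xs {f g : A → ℕ} → (∀ x → f x ≤ g x) → ∑ xs f ≤ ∑ xs g
  ∑-mono-≤ []       f≤g = z≤n
  ∑-mono-≤ (x ∷ xs) f≤g = +-mono-≤ (f≤g x) (∑-mono-≤ xs f≤g)

  ∑-distrib-+ : ∀ xs (f g : A → ℕ) → ∑[ x ∈ xs ] (f x + g x) ≡ ∑ xs f + ∑ xs g
  ∑-distrib-+ []       f g = refl
  ∑-distrib-+ (x ∷ xs) f g = begin
    f x + g x + ∑[ x ∈ xs ] (f x + g x) ≡⟨ cong (f x + g x +_) (∑-distrib-+ xs f g) ⟩
    f x + g x + (∑ xs f + ∑ xs g)       ≡⟨ +-assoc (f x) (g x) _ ⟩
    f x + (g x + (∑ xs f + ∑ xs g))     ≡⟨ cong (f x +_) (x+[y+z]≡y+[x+z] (g x) (∑ xs f) (∑ xs g)) ⟩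
    f x + (∑ xs f + (g x + ∑ xs g))     ≡⟨ +-assoc (f x) (∑ xs f) _ ⟨
    f x + ∑ xs f + (g x + ∑ xs g)       ∎
    where
    open ≡-Reasoning
    x+[y+z]≡y+[x+z] : ∀ x y z → x + (y + z) ≡ y + (x + z)
    x+[y+z]≡y+[x+z] x y z = trans (sym (+-assoc x y z)) (trans (cong (_+ z) (+-comm x y)) (+-assoc y x z))

  *-distribˡ-∑ : ∀ k xs (f : A → ℕ) → k * ∑ xs f ≡ ∑[ x ∈ xs ] (k * f x)
  *-distribˡ-∑ k []       f = *-zeroʳ k
  *-distribˡ-∑ k (x ∷ xs) f = trans (*-distribˡ-+ k (f x) _) (cong (k * f x +_) (*-distribˡ-∑ k xs f))

  *-distribʳ-∑ : ∀ k xs (f : A → ℕ) → ∑ xs f * k ≡ ∑[ x ∈ xs ] (f x * k)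
  *-distribʳ-∑ k []       f = refl
  *-distribʳ-∑ k (x ∷ xs) f = trans (*-distribʳ-+ k (f x) _) (cong (f x * k +_) (*-distribʳ-∑ k xs f))

  ∑-zero : ∀ (xs : List A) → ∑ xs (λ _ → 0) ≡ 0
  ∑-zero []       = refl
  ∑-zero (x ∷ xs) = ∑-zero xs

  ∑-map : ∀ {B : Set} (g : B → A) xs (f : A → ℕ) → ∑ (map g xs) f ≡ ∑ xs (f ∘ g)
  ∑-map g []       f = refl
  ∑-map g (x ∷ xs) f = cong (f (g x) +_) (∑-map g xs f)

  ∑-one : ∀ (xs : List A) → ∑ xs (λ _ → 1) ≡ length xs
  ∑-one []       = refl
  ∑-one (x ∷ xs) = cong suc (∑-one xs)

  ∑-𝟙-not+∑-𝟙≡length : ∀ xs (p : A → Bool) → ∑[ x ∈ xs ] 𝟙 (not (p x)) + ∑[ x ∈ xs ] 𝟙 (p x) ≡ length xs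
  ∑-𝟙-not+∑-𝟙≡length xs p = begin
    ∑[ x ∈ xs ] 𝟙 (not (p x)) + ∑[ x ∈ xs ] 𝟙 (p x) ≡⟨ ∑-distrib-+ xs _ _ ⟨
    ∑[ x ∈ xs ] (𝟙 (not (p x)) + 𝟙 (p x))            ≡⟨ ∑-cong xs (λ x → 𝟙-not+𝟙 (p x)) ⟩
    ∑ xs (λ _ → 1)                                    ≡⟨ ∑-one xs ⟩
    length xs                                         ∎
    where
    open ≡-Reasoning
    𝟙-not+𝟙 : ∀ b → 𝟙 (not b) + 𝟙 b ≡ 1
    𝟙-not+𝟙 true  = refl
    𝟙-not+𝟙 false = refl

  ∑≤length*bound : ∀ xs {f : A → ℕ} {c} → (∀ {x} → x ∈ xs → f x ≤ c) → ∑ xs f ≤ length xs * c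
  ∑≤length*bound []       f≤c = z≤n
  ∑≤length*bound (x ∷ xs) f≤c = +-mono-≤ (f≤c (here refl)) (∑≤length*bound xs (f≤c ∘ there))

  length-filter-𝟙 : ∀ (p : A → Bool) xs → length (filter (λ x → T? (p x)) xs) ≡ ∑[ x ∈ xs ] 𝟙 (p x)
  length-filter-𝟙 p []       = refl
  length-filter-𝟙 p (x ∷ xs) with p x
  ... | true  = cong suc (length-filter-𝟙 p xs)
  ... | false = length-filter-𝟙 p xs

  𝟙-any≤∑ : ∀ (p : A → Bool) xs → 𝟙 (any p xs) ≤ ∑[ x ∈ xs ] 𝟙 (p x)
  𝟙-any≤∑ p []       = z≤n
  𝟙-any≤∑ p (x ∷ xs) with p x
  ... | true  = s≤s z≤n
  ... | false = 𝟙-any≤∑ p xs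

∑-comm : ∀ {A B : Set} xs ys (h : A → B → ℕ) → ∑[ x ∈ xs ] ∑[ y ∈ ys ] h x y ≡ ∑[ y ∈ ys ] ∑[ x ∈ xs ] h x y
∑-comm []       ys h = sym (∑-zero ys)
∑-comm (x ∷ xs) ys h = trans (cong (∑ ys (h x) +_) (∑-comm xs ys h)) (sym (∑-distrib-+ ys (h x) _))

∑-cartesianProductWith : ∀ {A B C : Set} (g : A → B → C) xs ys (f : C → ℕ) →
                         ∑ (cartesianProductWith g xs ys) f ≡ ∑[ x ∈ xs ] ∑[ y ∈ ys ] f (g x y)
∑-cartesianProductWith g []       ys f = refl
∑-cartesianProductWith g (x ∷ xs) ys f =
  trans (∑-++ (map (g x) ys) _ f) (cong₂ _+_ (∑-map (g x) ys f) (∑-cartesianProductWith g xs ys f))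

T-not⇒¬T : ∀ {b} → T (not b) → ¬ T b
T-not⇒¬T {false} _ ()

𝟙≤𝟙-∧-not+𝟙 : ∀ a b → 𝟙 a ≤ 𝟙 (a ∧ not b) + 𝟙 b
𝟙≤𝟙-∧-not+𝟙 false b     = z≤n
𝟙≤𝟙-∧-not+𝟙 true  false = s≤s z≤n
𝟙≤𝟙-∧-not+𝟙 true  true  = s≤s z≤n

∑-𝟙-<ᵇ : ∀ {q} z → z ≤ q → ∑[ a ∈ allFin q ] 𝟙 (toℕ a <ᵇ z) ≡ z
∑-𝟙-<ᵇ {q}     zero    _         = ∑-zero (allFin q)
∑-𝟙-<ᵇ {suc q} (suc z) (s≤s z≤q) = cong suc (begin
  ∑[ a ∈ tabulate {n = q} Fin.suc ] 𝟙 (toℕ a <ᵇ suc z) ≡⟨ cong (λ as → ∑[ a ∈ as ] 𝟙 (toℕ a <ᵇ suc z)) (map-tabulate {n = q} (λ a → a) Fin.suc) ⟨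
  ∑[ a ∈ map Fin.suc (allFin q) ] 𝟙 (toℕ a <ᵇ suc z) ≡⟨ ∑-map Fin.suc (allFin q) _ ⟩
  ∑[ a ∈ allFin q ] 𝟙 (toℕ a <ᵇ z)                  ≡⟨ ∑-𝟙-<ᵇ z z≤q ⟩
  z                                                 ∎)
  where open ≡-Reasoning

module _ {q : ℕ} where

  size : (Fin q → Bool) → ℕ
  size P = ∑[ a ∈ allFin q ] 𝟙 (P a)

  Pattern : Set
  Pattern = List (Fin q → Bool)

  matches : Pattern → List (Fin q) → Bool
  matches []      []      = true
  matches (P ∷ π) (a ∷ l) = P a ∧ matches π l
  matches _       _       = false

  volume : Pattern → ℕ
  volume π = product (map size π)

  volume-++ : ∀ π ρ → volume (π ++ ρ) ≡ volume π * volume ρ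
  volume-++ π ρ = trans (cong product (map-++ size π ρ)) (product-++ (map size π) (map size ρ))

  volume-replicate : ∀ m P → volume (replicate m P) ≡ size P ^ m
  volume-replicate zero    P = refl
  volume-replicate (suc m) P = cong (size P *_) (volume-replicate m P)

  volume-replicate-++ : ∀ m P π → volume (replicate m P ++ π) ≡ size P ^ m * volume π
  volume-replicate-++ m P π = trans (volume-++ (replicate m P) π) (cong (_* volume π) (volume-replicate m P))

  ∑-matches : ∀ {n} π → length π ≡ n → ∑[ w ∈ allWords n ] 𝟙 (matches π (toList w)) ≡ volume π
  ∑-matches []      refl = refl
  ∑-matches (P ∷ π) refl = begin
    ∑[ w ∈ allWords (suc (length π)) ] 𝟙 (matches (P ∷ π) (toList w))
      ≡⟨ ∑-cartesianProductWith _∷_ (allFin q) (allWords (length π)) _ ⟩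
    ∑[ a ∈ allFin q ] ∑[ w ∈ allWords (length π) ] 𝟙 (P a ∧ matches π (toList w))
      ≡⟨ ∑-cong (allFin q) (λ a → ∑-cong (allWords (length π)) (λ w → 𝟙-∧ (P a) _)) ⟩
    ∑[ a ∈ allFin q ] ∑[ w ∈ allWords (length π) ] (𝟙 (P a) * 𝟙 (matches π (toList w)))
      ≡⟨ ∑-cong (allFin q) (λ a → *-distribˡ-∑ (𝟙 (P a)) (allWords (length π)) _) ⟨
    ∑[ a ∈ allFin q ] (𝟙 (P a) * ∑[ w ∈ allWords (length π) ] 𝟙 (matches π (toList w)))
      ≡⟨ ∑-cong (allFin q) (λ a → cong (𝟙 (P a) *_) (∑-matches π refl)) ⟩
    ∑[ a ∈ allFin q ] (𝟙 (P a) * volume π)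
      ≡⟨ *-distribʳ-∑ (volume π) (allFin q) _ ⟨
    size P * volume π
      ∎
    where
    open ≡-Reasoning
    𝟙-∧ : ∀ a b → 𝟙 (a ∧ b) ≡ 𝟙 a * 𝟙 b
    𝟙-∧ true  b = sym (+-identityʳ (𝟙 b))
    𝟙-∧ false b = refl

  matches⇒length≡ : ∀ π l → T (matches π l) → length l ≡ length π
  matches⇒length≡ []      []      _ = refl
  matches⇒length≡ (P ∷ π) (a ∷ l) m = cong suc (matches⇒length≡ π l (proj₂ (Equivalence.to T-∧ m)))

  matches-++⁻ : ∀ π ρ l → T (matches (π ++ ρ) l) →
                ∃₂ λ l₁ l₂ → l ≡ l₁ ++ l₂ × T (matches π l₁) × T (matches ρ l₂)
  matches-++⁻ []      ρ l       m = [] , l , refl , _ , m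
  matches-++⁻ (P ∷ π) ρ (a ∷ l) m
    with Pa , m′ ← Equivalence.to T-∧ m
    with l₁ , l₂ , refl , m₁ , m₂ ← matches-++⁻ π ρ l m′ =
    a ∷ l₁ , l₂ , refl , Equivalence.from T-∧ (Pa , m₁) , m₂

  matches-++⁺ : ∀ π ρ l₁ l₂ → T (matches π l₁) → T (matches ρ l₂) → T (matches (π ++ ρ) (l₁ ++ l₂))
  matches-++⁺ []      ρ []       l₂ _  m₂ = m₂
  matches-++⁺ (P ∷ π) ρ (a ∷ l₁) l₂ m₁ m₂ with Pa , m₁′ ← Equivalence.to T-∧ m₁ =
    Equivalence.from T-∧ (Pa , matches-++⁺ π ρ l₁ l₂ m₁′ m₂)

  matches-replicate⁺ : ∀ {P m} l → length l ≡ m → All (T ∘ P) l → T (matches (replicate m P) l)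
  matches-replicate⁺ []      refl []        = _
  matches-replicate⁺ (a ∷ l) refl (Pa ∷ Pl) = Equivalence.from T-∧ (Pa , matches-replicate⁺ l refl Pl)

  matches-∷⁻ : ∀ {P π} l → T (matches (P ∷ π) l) → ∃₂ λ a l′ → l ≡ a ∷ l′ × T (P a) × T (matches π l′)
  matches-∷⁻ (a ∷ l) m with Pa , m′ ← Equivalence.to T-∧ m = a , l , refl , Pa , m′

  matches-replicate⁻ : ∀ {P} m l → T (matches (replicate m P) l) → All (T ∘ P) l
  matches-replicate⁻ zero    []      _ = []
  matches-replicate⁻ (suc m) (a ∷ l) r with Pa , r′ ← Equivalence.to T-∧ r = Pa ∷ matches-replicate⁻ m l r′

-- The block code and the lower bound

module _ {A : Set} {P : A → Set} (k : ℕ) where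

  prefix-block⇒¬prefix≡suffix :
    ∀ {n} (u v : List A) → All P (take k u) →
    (∀ s → 1 ≤ s → s < n → ¬ All P (take k (drop s v))) →
    ∀ j → 1 ≤ j → j < n → take j u ≢ drop (n ∸ j) v
  prefix-block⇒¬prefix≡suffix {n} u v block-at-0 no-block j 1≤j j<n eq =
    no-block (n ∸ j) (m<n⇒0<n∸m j<n) (∸-monoʳ-< 1≤j (<⇒≤ j<n)) (subst (All P) window (Allₚ.take⁺ j block-at-0))
    where
    open ≡-Reasoning
    window : take j (take k u) ≡ take k (drop (n ∸ j) v)
    window = begin
      take j (take k u)  ≡⟨ take-take j k u ⟩
      take (j ⊓ k) u     ≡⟨ cong (λ i → take i u) (⊓-comm j k) ⟩
      take (k ⊓ j) u     ≡⟨ take-take k j u ⟨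
      take k (take j u)  ≡⟨ cong (take k) eq ⟩
      take k (drop (n ∸ j) v) ∎

-- a = z^k, b = q^k, c the size of the code, X the number of framed words, S the sieved excess.
sieve-arithmetic : ∀ a b c X S N Q →
  a * Q ≤ 4 * (b * X) → X ≤ c + S → b * b * S ≤ N * (a * a * Q) → 8 * N * a ≤ b →
  a * Q ≤ 8 * b * c
sieve-arithmetic a zero      c X S N Q aQ≤0 _ _ _ = ≤-trans aQ≤0 z≤n
sieve-arithmetic a b@(suc _) c X S N Q aQ≤4bX X≤c+S bbS≤NaaQ 8Na≤b =
  *-cancelˡ-≤ b (subst (b * (a * Q) ≤_) (8*[bbc]≡b*[8bc] b c) Y≤8bbc)
  where
  open ≤-Reasoning
  Y : ℕ
  Y = b * (a * Q)
  2Y≤8bbc+Y : Y + Y ≤ 8 * (b * b * c) + Y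
  2Y≤8bbc+Y = begin
    Y + Y                                   ≤⟨ +-mono-≤ (*-monoʳ-≤ b aQ≤4bX) (*-monoʳ-≤ b aQ≤4bX) ⟩
    b * (4 * (b * X)) + b * (4 * (b * X))   ≡⟨ b*[4*[bX]]+b*[4*[bX]]≡8*[bbX] b X ⟩
    8 * (b * b * X)                         ≤⟨ *-monoʳ-≤ 8 (*-monoʳ-≤ (b * b) X≤c+S) ⟩
    8 * (b * b * (c + S))                   ≡⟨ cong (8 *_) (*-distribˡ-+ (b * b) c S) ⟩
    8 * (b * b * c + b * b * S)             ≡⟨ *-distribˡ-+ 8 (b * b * c) (b * b * S) ⟩
    8 * (b * b * c) + 8 * (b * b * S)       ≤⟨ +-monoʳ-≤ (8 * (b * b * c)) (*-monoʳ-≤ 8 bbS≤NaaQ) ⟩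
    8 * (b * b * c) + 8 * (N * (a * a * Q)) ≡⟨ cong (8 * (b * b * c) +_) (8N*a*[aQ]≡8*[N*[aaQ]] N a Q) ⟨
    8 * (b * b * c) + 8 * N * a * (a * Q)   ≤⟨ +-monoʳ-≤ (8 * (b * b * c)) (*-monoˡ-≤ (a * Q) 8Na≤b) ⟩
    8 * (b * b * c) + Y                     ∎
    where
    b*[4*[bX]]+b*[4*[bX]]≡8*[bbX] : ∀ b X → b * (4 * (b * X)) + b * (4 * (b * X)) ≡ 8 * (b * b * X)
    b*[4*[bX]]+b*[4*[bX]]≡8*[bbX] = solve-∀
    8N*a*[aQ]≡8*[N*[aaQ]] : ∀ N a Q → 8 * N * a * (a * Q) ≡ 8 * (N * (a * a * Q))
    8N*a*[aQ]≡8*[N*[aaQ]] = solve-∀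
  Y≤8bbc : Y ≤ 8 * (b * b * c)
  Y≤8bbc = +-cancelʳ-≤ Y Y _ 2Y≤8bbc+Y
  8*[bbc]≡b*[8bc] : ∀ b c → 8 * (b * b * c) ≡ b * (8 * b * c)
  8*[bbc]≡b*[8bc] = solve-∀

module Construction {q : ℕ} (z k n : ℕ) where

  small large anyLetter : Fin q → Bool
  small a     = toℕ a <ᵇ z
  large a     = not (small a)
  anyLetter _ = true

  largeEnds : ℕ → Pattern
  largeEnds zero    = [ large ]
  largeEnds (suc r) = large ∷ replicate r anyLetter ++ [ large ]

  frame : Pattern
  frame = replicate k small ++ largeEnds (n ∸ suc k)

  -- twoBlocks t has a second block of k small letters at position suc k + t; for t < N that
  -- block ends before the last letter.
  N : ℕ
  N = n ∸ suc (k + k)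

  twoBlocks : ℕ → Pattern
  twoBlocks t = replicate k small ++ replicate (suc t) anyLetter ++ replicate k small ++ replicate (n ∸ (suc k + t + k)) anyLetter

  isCodeword : List (Fin q) → Bool
  isCodeword l = matches frame l ∧ not (any (λ t → matches (twoBlocks t) l) (upTo N))

  blockCode : Code n q
  blockCode = code (filter (T? ∘ isCodeword ∘ toList) (allWords n)) (Uniqueₚ.filter⁺ (T? ∘ isCodeword ∘ toList) (allWords-unique n))

  largeEnds-head : ∀ r → ∃ λ π → largeEnds r ≡ large ∷ π
  largeEnds-head zero    = [] , refl
  largeEnds-head (suc r) = replicate r anyLetter ++ [ large ] , refl

  largeEnds-last : ∀ r → ∃ λ π → largeEnds r ≡ π ++ [ large ]
  largeEnds-last zero    = [] , refl
  largeEnds-last (suc r) = large ∷ replicate r anyLetter , refl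

  frame-start : ∀ l → T (matches frame l) →
                ∃₂ λ zs b → ∃ λ l′ → l ≡ zs ++ b ∷ l′ × length zs ≡ k × All (T ∘ small) zs × T (large b)
  frame-start l m
    with π , eq ← largeEnds-head (n ∸ suc k)
    with zs , l₂ , refl , m₁ , m₂ ← matches-++⁻ (replicate k small) _ l m
    with b , l′ , refl , large-b , _ ← matches-∷⁻ l₂ (subst (λ π → T (matches π l₂)) eq m₂) =
    zs , b , l′ , refl ,
    trans (matches⇒length≡ (replicate k small) zs m₁) (length-replicate k) , matches-replicate⁻ k zs m₁ , large-b

  frame-end : ∀ l → T (matches frame l) → ∃₂ λ l′ b → l ≡ l′ ++ [ b ] × T (large b)
  frame-end l m
    with π , eq ← largeEnds-last (n ∸ suc k)
    with l₁ , l₂ , refl , _ , m₂ ← matches-++⁻ (replicate k small ++ π) [ large ] l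
           (subst (λ ρ → T (matches ρ l)) (trans (cong (replicate k small ++_) eq) (sym (++-assoc (replicate k small) π _))) m)
    with b , [] , refl , large-b , _ ← matches-∷⁻ l₂ m₂ = l₁ , b , refl , large-b

  frame⇒block-at-0 : ∀ l → T (matches frame l) → All (T ∘ small) (take k l)
  frame⇒block-at-0 l m with zs , b , l′ , refl , refl , small-zs , _ ← frame-start l m =
    subst (All (T ∘ small)) (sym (take-length-++ zs (b ∷ l′))) small-zs

  k+[1+t+[k+m]]≡n : ∀ t → suc k + t + k ≤ n → k + (suc t + (k + (n ∸ (suc k + t + k)))) ≡ n
  k+[1+t+[k+m]]≡n t fits = trans (reassociate k t (n ∸ (suc k + t + k))) (m+[n∸m]≡n fits)
    where
    reassociate : ∀ k t m → k + (suc t + (k + m)) ≡ suc k + t + k + m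
    reassociate = solve-∀

  length-twoBlocks : ∀ t → suc k + t + k ≤ n → length (twoBlocks t) ≡ n
  length-twoBlocks t fits =
    trans (length-replicate-++ k (length-replicate-++ (suc t) (length-replicate-++ k (length-replicate _))))
          (k+[1+t+[k+m]]≡n t fits)

  two-blocks⇒matches-twoBlocks : ∀ t l → length l ≡ n → suc k + t + k ≤ n →
    All (T ∘ small) (take k l) → All (T ∘ small) (take k (drop (suc k + t) l)) → T (matches (twoBlocks t) l)
  two-blocks⇒matches-twoBlocks t l |l|≡n fits block₁ block₂ =
    subst (T ∘ matches (twoBlocks t)) (sym l≡pieces)
      (matches-++⁺ (replicate k small) _ (take k l) _ (matches-replicate⁺ _ |take-k-l| block₁)
      (matches-++⁺ (replicate (suc t) anyLetter) _ gap _ (matches-replicate⁺ gap |gap| (All.universal _ gap))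
      (matches-++⁺ (replicate k small) _ (take k (drop s l)) _ (matches-replicate⁺ _ |take-k-drop-s-l| block₂)
        (matches-replicate⁺ rest |rest| (All.universal _ rest)))))
    where
    open ≡-Reasoning
    s : ℕ
    s = suc k + t
    gap rest : List (Fin q)
    gap = drop k (take s l)
    rest = drop k (drop s l)
    s≤n : s ≤ n
    s≤n = ≤-trans (m≤m+n s k) fits
    k≤s : k ≤ s
    k≤s = ≤-trans (n≤1+n k) (m≤m+n (suc k) t)
    |drop-s-l| : length (drop s l) ≡ n ∸ s
    |drop-s-l| = trans (length-drop s l) (cong (_∸ s) |l|≡n)
    |take-k-l| : length (take k l) ≡ k
    |take-k-l| = length-take-≤ k l (subst (k ≤_) (sym |l|≡n) (≤-trans k≤s s≤n))
    |gap| : length gap ≡ suc t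
    |gap| = begin
      length (drop k (take s l)) ≡⟨ length-drop k (take s l) ⟩
      length (take s l) ∸ k      ≡⟨ cong (_∸ k) (length-take-≤ s l (subst (s ≤_) (sym |l|≡n) s≤n)) ⟩
      suc k + t ∸ k              ≡⟨ cong (_∸ k) (+-comm (suc k) t) ⟩
      t + suc k ∸ k              ≡⟨ cong (_∸ k) (+-suc t k) ⟩
      suc (t + k) ∸ k            ≡⟨ +-∸-assoc 1 (m≤n+m k t) ⟩
      suc (t + k ∸ k)            ≡⟨ cong suc (m+n∸n≡m t k) ⟩
      suc t                      ∎
    |take-k-drop-s-l| : length (take k (drop s l)) ≡ k
    |take-k-drop-s-l| = length-take-≤ k (drop s l)
      (subst (k ≤_) (sym |drop-s-l|) (m+n≤o⇒m≤o∸n k (subst (_≤ n) (+-comm s k) fits)))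
    |rest| : length rest ≡ n ∸ (suc k + t + k)
    |rest| = trans (length-drop k (drop s l)) (trans (cong (_∸ k) |drop-s-l|) (∸-+-assoc n s k))
    l≡pieces : l ≡ take k l ++ gap ++ take k (drop s l) ++ rest
    l≡pieces = begin
      l                                             ≡⟨ take++drop≡id s l ⟨
      take s l ++ drop s l                          ≡⟨ cong₂ _++_ (take++drop≡id k (take s l)) (take++drop≡id k (drop s l)) ⟨
      (take k (take s l) ++ gap) ++ (take k (drop s l) ++ rest)
        ≡⟨ cong (λ xs → (xs ++ gap) ++ (take k (drop s l) ++ rest)) (trans (take-take k s l) (cong (λ i → take i l) (m≤n⇒m⊓n≡m k≤s))) ⟩
      (take k l ++ gap) ++ (take k (drop s l) ++ rest) ≡⟨ ++-assoc (take k l) gap _ ⟩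
      take k l ++ gap ++ take k (drop s l) ++ rest  ∎

  <N⇒fits : ∀ {t} → t < N → suc k + t + k ≤ n
  <N⇒fits {t} t<N = ≤-trans (n≤1+n _) (subst (_≤ n) (reassociate t k) (m≤o∸n⇒m+n≤o (suc t) room t<N))
    where
    room : suc (k + k) ≤ n
    room = <⇒≤ (m∸n≢0⇒n<m (m<n⇒n≢0 t<N))
    reassociate : ∀ t k → suc t + suc (k + k) ≡ suc (suc k + t + k)
    reassociate = solve-∀

  fits⇒<N : ∀ {t} → suc k + t + k < n → t < N
  fits⇒<N {t} fits = m+n≤o⇒m≤o∸n (suc t) (subst (_≤ n) (reassociate t k) fits)
    where
    reassociate : ∀ t k → suc (suc k + t + k) ≡ suc t + suc (k + k)
    reassociate = solve-∀

  -- A block starting at s covers position k if s ≤ k, the last position if n ≤ s + k, and is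
  -- sieved out by twoBlocks otherwise.
  codeword⇒no-late-block : ∀ l → length l ≡ n → T (isCodeword l) →
                           ∀ s → 1 ≤ s → s < n → ¬ All (T ∘ small) (take k (drop s l))
  codeword⇒no-late-block l |l|≡n codeword s 1≤s s<n block
    with matches-frame , no-twoBlocks ← Equivalence.to T-∧ codeword
    with s ≤? k
  ... | yes s≤k with zs , b , l′ , refl , refl , _ , large-b ← frame-start l matches-frame =
    T-not⇒¬T large-b (All-take-drop⇒at (length zs) s zs s≤k (m<n+m (length zs) 1≤s) block)
  ... | no s≰k with n ≤? s + k
  ...   | yes n≤s+k with l′ , b , refl , large-b ← frame-end l matches-frame =
    T-not⇒¬T large-b (All-take-drop⇒at k s l′ (≤-pred (subst (s <_) |l|≡|l′|+1 s<n)) (subst (_≤ s + k) |l|≡|l′|+1 n≤s+k) block)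
    where
    |l|≡|l′|+1 : n ≡ suc (length l′)
    |l|≡|l′|+1 = trans (sym |l|≡n) (trans (length-++ l′) (+-comm (length l′) 1))
  ...   | no n≰s+k with t , refl ← m≤n⇒∃[o]m+o≡n (≰⇒> s≰k) =
    T-not⇒¬T no-twoBlocks (any⁺ _ (lose (∈-upTo⁺ (fits⇒<N (≰⇒> n≰s+k)))
      (two-blocks⇒matches-twoBlocks t l |l|≡n (<⇒≤ (≰⇒> n≰s+k)) (frame⇒block-at-0 l matches-frame) block)))

  ∈-blockCode⇒codeword : ∀ {w} → w ∈ words blockCode → T (isCodeword (toList w))
  ∈-blockCode⇒codeword w∈ = proj₂ (∈-filter⁻ (T? ∘ isCodeword ∘ toList) {xs = allWords n} w∈)

  codewords-¬prefix≡suffix : ∀ {u v} → u ∈ words blockCode → v ∈ words blockCode →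
                             ∀ j → 1 ≤ j → j < n → take j (toList u) ≢ drop (n ∸ j) (toList v)
  codewords-¬prefix≡suffix {u} {v} u∈ v∈ =
    prefix-block⇒¬prefix≡suffix k (toList u) (toList v)
      (frame⇒block-at-0 (toList u) (proj₁ (Equivalence.to T-∧ (∈-blockCode⇒codeword u∈))))
      (codeword⇒no-late-block (toList v) (Vecₚ.length-toList v) (∈-blockCode⇒codeword v∈))

  blockCode-nonOverlapping : NonOverlapping blockCode
  blockCode-nonOverlapping u v u∈ v∈ (j , 1≤j , j<n , inj₁ eq) = codewords-¬prefix≡suffix u∈ v∈ j 1≤j j<n eq
  blockCode-nonOverlapping u v u∈ v∈ (j , 1≤j , j<n , inj₂ eq) = codewords-¬prefix≡suffix v∈ u∈ j 1≤j j<n eq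

  k+[1+[n∸1+k]]≡n : k < n → k + suc (n ∸ suc k) ≡ n
  k+[1+[n∸1+k]]≡n k<n = trans (+-suc k (n ∸ suc k)) (m+[n∸m]≡n k<n)

  length-frame : k < n → length frame ≡ n
  length-frame k<n = trans (length-replicate-++ k (length-largeEnds (n ∸ suc k))) (k+[1+[n∸1+k]]≡n k<n)
    where
    length-largeEnds : ∀ r → length (largeEnds r) ≡ suc r
    length-largeEnds zero    = refl
    length-largeEnds (suc r) = cong suc (trans (length-replicate-++ r refl) (+-comm r 1))

  card-blockCode : card blockCode ≡ ∑[ w ∈ allWords n ] 𝟙 (isCodeword (toList w))
  card-blockCode = length-filter-𝟙 (isCodeword ∘ toList) (allWords n)

  volume-frame≤card+∑twoBlocks : k < n → volume frame ≤ card blockCode + ∑[ t ∈ upTo N ] ∑[ w ∈ allWords n ] 𝟙 (matches (twoBlocks t) (toList w))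
  volume-frame≤card+∑twoBlocks k<n = begin
    volume frame
      ≡⟨ ∑-matches frame (length-frame k<n) ⟨
    ∑[ w ∈ allWords n ] 𝟙 (matches frame (toList w))
      ≤⟨ ∑-mono-≤ (allWords n) (λ w → 𝟙-frame≤ (toList w)) ⟩
    ∑[ w ∈ allWords n ] (𝟙 (isCodeword (toList w)) + ∑[ t ∈ upTo N ] 𝟙 (matches (twoBlocks t) (toList w)))
      ≡⟨ ∑-distrib-+ (allWords n) _ _ ⟩
    ∑[ w ∈ allWords n ] 𝟙 (isCodeword (toList w)) + ∑[ w ∈ allWords n ] ∑[ t ∈ upTo N ] 𝟙 (matches (twoBlocks t) (toList w))
      ≡⟨ cong₂ _+_ card-blockCode (∑-comm (upTo N) (allWords n) _) ⟨
    card blockCode + ∑[ t ∈ upTo N ] ∑[ w ∈ allWords n ] 𝟙 (matches (twoBlocks t) (toList w))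
      ∎
    where
    open ≤-Reasoning
    𝟙-frame≤ : ∀ l → 𝟙 (matches frame l) ≤ 𝟙 (isCodeword l) + ∑[ t ∈ upTo N ] 𝟙 (matches (twoBlocks t) l)
    𝟙-frame≤ l = ≤-trans (𝟙≤𝟙-∧-not+𝟙 (matches frame l) _) (+-monoʳ-≤ (𝟙 (isCodeword l)) (𝟙-any≤∑ _ (upTo N)))

  size-small : z ≤ q → size small ≡ z
  size-small = ∑-𝟙-<ᵇ z

  size-large : z ≤ q → size large ≡ q ∸ z
  size-large z≤q = begin
    size large              ≡⟨ m+n∸n≡m (size large) z ⟨
    size large + z ∸ z      ≡⟨ cong (λ x → size large + x ∸ z) (size-small z≤q) ⟨
    size large + size small ∸ z ≡⟨ cong (_∸ z) (∑-𝟙-not+∑-𝟙≡length (allFin q) small) ⟩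
    length (allFin q) ∸ z   ≡⟨ cong (_∸ z) (length-tabulate {n = q} (λ a → a)) ⟩
    q ∸ z                   ∎
    where open ≡-Reasoning

  size-anyLetter : size anyLetter ≡ q
  size-anyLetter = trans (∑-one (allFin q)) (length-tabulate {n = q} (λ a → a))

  q^[1+r]≤4*volume-largeEnds : q ≤ 2 * size large → ∀ r → q ^ suc r ≤ 4 * volume (largeEnds r)
  q^[1+r]≤4*volume-largeEnds q≤2d zero = begin
    q * 1              ≤⟨ *-monoˡ-≤ 1 q≤2d ⟩
    2 * size large * 1 ≤⟨ *-monoˡ-≤ 1 (*-monoˡ-≤ (size large) (m≤m+n 2 2)) ⟩
    4 * size large * 1 ≡⟨ *-assoc 4 (size large) 1 ⟩
    4 * volume [ large ] ∎
    where open ≤-Reasoning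
  q^[1+r]≤4*volume-largeEnds q≤2d (suc r) = begin
    q * (q * q ^ r)                           ≤⟨ *-mono-≤ q≤2d (*-monoˡ-≤ (q ^ r) q≤2d) ⟩
    2 * d * (2 * d * q ^ r)                   ≡⟨ 2d*[2d*x]≡4*[d*[x*[d*1]]] d (q ^ r) ⟩
    4 * (d * (q ^ r * (d * 1)))               ≡⟨ cong (λ x → 4 * (d * x)) volume-tail ⟨
    4 * volume (largeEnds (suc r))            ∎
    where
    open ≤-Reasoning
    d : ℕ
    d = size large
    volume-tail : volume (replicate r anyLetter ++ [ large ]) ≡ q ^ r * (d * 1)
    volume-tail = trans (volume-++ (replicate r anyLetter) [ large ])
                        (cong (_* (d * 1)) (trans (volume-replicate r anyLetter) (cong (_^ r) size-anyLetter)))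
    2d*[2d*x]≡4*[d*[x*[d*1]]] : ∀ d x → 2 * d * (2 * d * x) ≡ 4 * (d * (x * (d * 1)))
    2d*[2d*x]≡4*[d*[x*[d*1]]] = solve-∀

  z^k*q^n≤4*q^k*volume-frame : z ≤ q → q ≤ 2 * (q ∸ z) → k < n → z ^ k * q ^ n ≤ 4 * (q ^ k * volume frame)
  z^k*q^n≤4*q^k*volume-frame z≤q q≤2d k<n = begin
    z ^ k * q ^ n                     ≡⟨ cong (λ m → z ^ k * q ^ m) (k+[1+[n∸1+k]]≡n k<n) ⟨
    z ^ k * q ^ (k + suc r)           ≡⟨ cong (z ^ k *_) (^-distribˡ-+-* q k (suc r)) ⟩
    z ^ k * (q ^ k * q ^ suc r)       ≤⟨ *-monoʳ-≤ (z ^ k) (*-monoʳ-≤ (q ^ k) (q^[1+r]≤4*volume-largeEnds q≤2*size-large r)) ⟩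
    z ^ k * (q ^ k * (4 * V))         ≡⟨ x*[y*[4*v]]≡4*[y*[x*v]] (z ^ k) (q ^ k) V ⟩
    4 * (q ^ k * (z ^ k * V))         ≡⟨ cong (λ x → 4 * (q ^ k * x)) volume-frame ⟨
    4 * (q ^ k * volume frame)        ∎
    where
    open ≤-Reasoning
    r V : ℕ
    r = n ∸ suc k
    V = volume (largeEnds r)
    q≤2*size-large : q ≤ 2 * size large
    q≤2*size-large = subst (λ d → q ≤ 2 * d) (sym (size-large z≤q)) q≤2d
    volume-frame : volume frame ≡ z ^ k * V
    volume-frame = trans (volume-++ (replicate k small) (largeEnds r))
                         (cong (_* V) (trans (volume-replicate k small) (cong (_^ k) (size-small z≤q))))
    x*[y*[4*v]]≡4*[y*[x*v]] : ∀ x y v → x * (y * (4 * v)) ≡ 4 * (y * (x * v))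
    x*[y*[4*v]]≡4*[y*[x*v]] = solve-∀

  q^k*q^k*volume-twoBlocks : z ≤ q → ∀ t → suc k + t + k ≤ n → q ^ k * q ^ k * volume (twoBlocks t) ≡ z ^ k * z ^ k * q ^ n
  q^k*q^k*volume-twoBlocks z≤q t fits = begin
    q ^ k * q ^ k * volume (twoBlocks t)                      ≡⟨ cong (q ^ k * q ^ k *_) volume-twoBlocks ⟩
    q ^ k * q ^ k * (z ^ k * (q ^ suc t * (z ^ k * q ^ m)))   ≡⟨ b*b*[a*[x*[a*y]]]≡a*a*[b*[x*[b*y]]] (q ^ k) (z ^ k) (q ^ suc t) (q ^ m) ⟩
    z ^ k * z ^ k * (q ^ k * (q ^ suc t * (q ^ k * q ^ m)))   ≡⟨ cong (z ^ k * z ^ k *_) q^n-split ⟨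
    z ^ k * z ^ k * q ^ n                                     ∎
    where
    open ≡-Reasoning
    m : ℕ
    m = n ∸ (suc k + t + k)
    volume-twoBlocks : volume (twoBlocks t) ≡ z ^ k * (q ^ suc t * (z ^ k * q ^ m))
    volume-twoBlocks = begin
      volume (twoBlocks t)
        ≡⟨ volume-replicate-++ k small _ ⟩
      size small ^ k * volume (replicate (suc t) anyLetter ++ replicate k small ++ replicate m anyLetter)
        ≡⟨ cong (size small ^ k *_) (volume-replicate-++ (suc t) anyLetter _) ⟩
      size small ^ k * (size anyLetter ^ suc t * volume (replicate k small ++ replicate m anyLetter))
        ≡⟨ cong (λ x → size small ^ k * (size anyLetter ^ suc t * x)) (volume-replicate-++ k small _) ⟩
      size small ^ k * (size anyLetter ^ suc t * (size small ^ k * volume (replicate m anyLetter)))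
        ≡⟨ cong (λ x → size small ^ k * (size anyLetter ^ suc t * (size small ^ k * x))) (volume-replicate m anyLetter) ⟩
      size small ^ k * (size anyLetter ^ suc t * (size small ^ k * size anyLetter ^ m))
        ≡⟨ cong₂ (λ a x → a ^ k * (x ^ suc t * (a ^ k * x ^ m))) (size-small z≤q) size-anyLetter ⟩
      z ^ k * (q ^ suc t * (z ^ k * q ^ m)) ∎
    q^n-split : q ^ n ≡ q ^ k * (q ^ suc t * (q ^ k * q ^ m))
    q^n-split = begin
      q ^ n                                     ≡⟨ cong (q ^_) (k+[1+t+[k+m]]≡n t fits) ⟨
      q ^ (k + (suc t + (k + m)))               ≡⟨ ^-distribˡ-+-* q k _ ⟩
      q ^ k * q ^ (suc t + (k + m))             ≡⟨ cong (q ^ k *_) (^-distribˡ-+-* q (suc t) _) ⟩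
      q ^ k * (q ^ suc t * q ^ (k + m))         ≡⟨ cong (λ x → q ^ k * (q ^ suc t * x)) (^-distribˡ-+-* q k m) ⟩
      q ^ k * (q ^ suc t * (q ^ k * q ^ m))     ∎
    b*b*[a*[x*[a*y]]]≡a*a*[b*[x*[b*y]]] : ∀ b a x y → b * b * (a * (x * (a * y))) ≡ a * a * (b * (x * (b * y)))
    b*b*[a*[x*[a*y]]]≡a*a*[b*[x*[b*y]]] = solve-∀

  z^k*q^n≤8*q^k*card : z ≤ q → q ≤ 2 * (q ∸ z) → k < n → 8 * N * z ^ k ≤ q ^ k → z ^ k * q ^ n ≤ 8 * q ^ k * card blockCode
  z^k*q^n≤8*q^k*card z≤q q≤2d k<n 8Nz^k≤q^k =
    sieve-arithmetic (z ^ k) (q ^ k) (card blockCode) (volume frame) S N (q ^ n)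
      (z^k*q^n≤4*q^k*volume-frame z≤q q≤2d k<n) (volume-frame≤card+∑twoBlocks k<n) q^k*q^k*S≤N*z^k*z^k*q^n 8Nz^k≤q^k
    where
    open ≤-Reasoning
    S : ℕ
    S = ∑[ t ∈ upTo N ] ∑[ w ∈ allWords n ] 𝟙 (matches (twoBlocks t) (toList w))
    q^k*q^k*S≤N*z^k*z^k*q^n : q ^ k * q ^ k * S ≤ N * (z ^ k * z ^ k * q ^ n)
    q^k*q^k*S≤N*z^k*z^k*q^n = begin
      q ^ k * q ^ k * S
        ≡⟨ *-distribˡ-∑ (q ^ k * q ^ k) (upTo N) _ ⟩
      ∑[ t ∈ upTo N ] (q ^ k * q ^ k * ∑[ w ∈ allWords n ] 𝟙 (matches (twoBlocks t) (toList w)))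
        ≤⟨ ∑≤length*bound (upTo N) each ⟩
      length (upTo N) * (z ^ k * z ^ k * q ^ n)
        ≡⟨ cong (_* (z ^ k * z ^ k * q ^ n)) (length-upTo N) ⟩
      N * (z ^ k * z ^ k * q ^ n) ∎
      where
      each : ∀ {t} → t ∈ upTo N → q ^ k * q ^ k * ∑[ w ∈ allWords n ] 𝟙 (matches (twoBlocks t) (toList w)) ≤ z ^ k * z ^ k * q ^ n
      each {t} t∈ = ≤-reflexive (trans (cong (q ^ k * q ^ k *_) (∑-matches (twoBlocks t) (length-twoBlocks t fits)))
                                       (q^k*q^k*volume-twoBlocks z≤q t fits))
        where
        fits : suc k + t + k ≤ n
        fits = <N⇒fits (∈-upTo⁻ t∈)

upward-search : ∀ {P Q : ℕ → Set} → (∀ k → Dec (P k)) → (∀ k → ¬ P k → Q (suc k)) →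
                ∀ {k₀} f → Q k₀ → P (k₀ + f) → ∃ λ k → k ≤ k₀ + f × Q k × P k
upward-search {P} P? step {k₀} zero Qk₀ Pk₀+0 = k₀ , m≤m+n k₀ 0 , Qk₀ , subst P (+-identityʳ k₀) Pk₀+0
upward-search {P} {Q} P? step {k₀} (suc f) Qk₀ Pk₀+1+f with P? k₀
... | yes Pk₀ = k₀ , m≤m+n k₀ (suc f) , Qk₀ , Pk₀
... | no ¬Pk₀ = subst (λ m → ∃ λ k → k ≤ m × Q k × P k) (sym (+-suc k₀ f))
                      (upward-search P? step f (step k₀ ¬Pk₀) (subst P (+-suc k₀ f) Pk₀+1+f))

⌈n/2⌉≤1+⌊n/2⌋ : ∀ n → ⌈ n /2⌉ ≤ suc ⌊ n /2⌋
⌈n/2⌉≤1+⌊n/2⌋ zero          = z≤n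
⌈n/2⌉≤1+⌊n/2⌋ (suc zero)    = ≤-refl
⌈n/2⌉≤1+⌊n/2⌋ (suc (suc n)) = s≤s (⌈n/2⌉≤1+⌊n/2⌋ n)

n∸⌊n/2⌋≡⌈n/2⌉ : ∀ n → n ∸ ⌊ n /2⌋ ≡ ⌈ n /2⌉
n∸⌊n/2⌋≡⌈n/2⌉ n = trans (cong (_∸ ⌊ n /2⌋) (sym (⌊n/2⌋+⌈n/2⌉≡n n))) (m+n∸m≡n ⌊ n /2⌋ ⌈ n /2⌉)

n≤2*[n∸⌊n/2⌋] : ∀ n → n ≤ 2 * (n ∸ ⌊ n /2⌋)
n≤2*[n∸⌊n/2⌋] n = begin
  n                           ≡⟨ ⌊n/2⌋+⌈n/2⌉≡n n ⟨
  ⌊ n /2⌋ + ⌈ n /2⌉           ≤⟨ +-monoˡ-≤ ⌈ n /2⌉ (⌊n/2⌋≤⌈n/2⌉ n) ⟩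
  ⌈ n /2⌉ + ⌈ n /2⌉           ≡⟨ cong (⌈ n /2⌉ +_) (+-identityʳ ⌈ n /2⌉) ⟨
  2 * ⌈ n /2⌉                 ≡⟨ cong (2 *_) (n∸⌊n/2⌋≡⌈n/2⌉ n) ⟨
  2 * (n ∸ ⌊ n /2⌋)           ∎
  where open ≤-Reasoning

n≤3*⌊n/2⌋ : ∀ n → 2 ≤ n → n ≤ 3 * ⌊ n /2⌋
n≤3*⌊n/2⌋ n 2≤n = begin
  n                             ≡⟨ ⌊n/2⌋+⌈n/2⌉≡n n ⟨
  ⌊ n /2⌋ + ⌈ n /2⌉             ≤⟨ +-monoʳ-≤ ⌊ n /2⌋ (⌈n/2⌉≤1+⌊n/2⌋ n) ⟩
  ⌊ n /2⌋ + suc ⌊ n /2⌋         ≤⟨ +-monoʳ-≤ ⌊ n /2⌋ (+-monoˡ-≤ ⌊ n /2⌋ (⌊n/2⌋-mono 2≤n)) ⟩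
  ⌊ n /2⌋ + (⌊ n /2⌋ + ⌊ n /2⌋) ≡⟨ cong (λ x → ⌊ n /2⌋ + (⌊ n /2⌋ + x)) (+-identityʳ ⌊ n /2⌋) ⟨
  3 * ⌊ n /2⌋                   ∎
  where open ≤-Reasoning

∃-block-length : ∀ {q z} n → 2 ≤ n → q ≤ 3 * z →
                 ∃ λ k → k < n × q ^ k ≤ 24 * n * z ^ k × 8 * (n ∸ suc (k + k)) * z ^ k ≤ q ^ k
∃-block-length {q} {z} n@(suc (suc n′)) (s≤s (s≤s z≤n)) q≤3z =
  map₂ (map₁ s≤s) (upward-search (λ k → 8 * (n ∸ suc (k + k)) * z ^ k ≤? q ^ k) step n′ q≤24nz saturated)
  where
  open ≤-Reasoning
  q≤24nz : q ^ 1 ≤ 24 * n * z ^ 1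
  q≤24nz = begin
    q * 1             ≤⟨ *-monoˡ-≤ 1 q≤3z ⟩
    3 * z * 1         ≤⟨ *-monoˡ-≤ 1 (*-monoˡ-≤ z (≤-trans (m≤m*n 3 n) (*-monoˡ-≤ n (m≤m+n 3 21)))) ⟩
    3 * 8 * n * z * 1 ≡⟨ 3*8*n*z*1≡24*n*[z*1] n z ⟩
    24 * n * (z * 1)  ∎
    where
    3*8*n*z*1≡24*n*[z*1] : ∀ n z → 3 * 8 * n * z * 1 ≡ 24 * n * (z * 1)
    3*8*n*z*1≡24*n*[z*1] = solve-∀
  step : ∀ k → ¬ (8 * (n ∸ suc (k + k)) * z ^ k ≤ q ^ k) → q ^ suc k ≤ 24 * n * z ^ suc k
  step k 8Nz^k≰q^k = begin
    q * q ^ k                               ≤⟨ *-mono-≤ q≤3z (<⇒≤ (≰⇒> 8Nz^k≰q^k)) ⟩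
    3 * z * (8 * (n ∸ suc (k + k)) * z ^ k) ≤⟨ *-monoʳ-≤ (3 * z) (*-monoˡ-≤ (z ^ k) (*-monoʳ-≤ 8 (m∸n≤m n (suc (k + k))))) ⟩
    3 * z * (8 * n * z ^ k)                 ≡⟨ 3z*[8na]≡24n*[za] n z (z ^ k) ⟩
    24 * n * (z * z ^ k)                    ∎
    where
    3z*[8na]≡24n*[za] : ∀ n z a → 3 * z * (8 * n * a) ≡ 24 * n * (z * a)
    3z*[8na]≡24n*[za] = solve-∀
  saturated : 8 * (n ∸ suc (suc n′ + suc n′)) * z ^ suc n′ ≤ q ^ suc n′
  saturated = subst (λ N → 8 * N * z ^ suc n′ ≤ q ^ suc n′) (sym (m≤n⇒m∸n≡0 (s≤s (m≤m+n (suc n′) (suc n′))))) z≤n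

lower-bound : ∀ n q → 2 ≤ n → 2 ≤ q → Σ (Code n q) λ C → NonOverlapping C × q ^ n ≤ 192 * n * card C
lower-bound n q 2≤n 2≤q = blockCode-for (∃-block-length n 2≤n (n≤3*⌊n/2⌋ q 2≤q))
  where
  z : ℕ
  z = ⌊ q /2⌋
  instance
    z≢0 : NonZero z
    z≢0 = >-nonZero (⌊n/2⌋-mono 2≤q)
  blockCode-for : (∃ λ k → k < n × q ^ k ≤ 24 * n * z ^ k × 8 * (n ∸ suc (k + k)) * z ^ k ≤ q ^ k) →
                  Σ (Code n q) λ C → NonOverlapping C × q ^ n ≤ 192 * n * card C
  blockCode-for (k , k<n , q^k≤24nz^k , 8Nz^k≤q^k) =
    blockCode , blockCode-nonOverlapping , *-cancelˡ-≤ (z ^ k) {{m^n≢0 z k}} (begin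
      z ^ k * q ^ n                         ≤⟨ z^k*q^n≤8*q^k*card (⌊n/2⌋≤n q) (n≤2*[n∸⌊n/2⌋] q) k<n 8Nz^k≤q^k ⟩
      8 * q ^ k * card blockCode            ≤⟨ *-monoˡ-≤ (card blockCode) (*-monoʳ-≤ 8 q^k≤24nz^k) ⟩
      8 * (24 * n * z ^ k) * card blockCode ≡⟨ 8*[24na]*c≡a*[192nc] n (z ^ k) (card blockCode) ⟩
      z ^ k * (192 * n * card blockCode)    ∎)
    where
    open Construction {q} z k n
    open ≤-Reasoning
    8*[24na]*c≡a*[192nc] : ∀ n a c → 8 * (24 * n * a) * c ≡ a * (192 * n * c)
    8*[24na]*c≡a*[192nc] = solve-∀

ℕtoℚ≡mkℚ : ∀ a → ℕtoℚ a ≡ ℚ.mkℚ (ℤ.+ a) 0 (Coprimality.sym (1-coprimeTo a))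
ℕtoℚ≡mkℚ a = ℚₚ.normalize-coprime (Coprimality.sym (1-coprimeTo a))

ℕtoℚ-*-homo : ∀ a b → ℕtoℚ a ℚ.* ℕtoℚ b ≡ ℕtoℚ (a * b)
ℕtoℚ-*-homo a b rewrite ℕtoℚ≡mkℚ a | ℕtoℚ≡mkℚ b = cong (ℚ._/ 1) (ℤₚ.+◃n≡+n (a * b))

ℕtoℚ-mono-≤ : ∀ {a b} → a ≤ b → ℕtoℚ a ℚ.≤ ℕtoℚ b
ℕtoℚ-mono-≤ {a} {b} a≤b rewrite ℕtoℚ≡mkℚ a | ℕtoℚ≡mkℚ b =
  ℚ.*≤* (subst₂ ℤ._≤_ (sym (ℤₚ.*-identityʳ (ℤ.+ a))) (sym (ℤₚ.*-identityʳ (ℤ.+ b))) (ℤ.+≤+ a≤b))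

c₁ : ℚ
c₁ = ℤ.+ 1 ℚ./ 192

c₁*192≡1 : c₁ ℚ.* ℕtoℚ 192 ≡ 1ℚ
c₁*192≡1 = refl

q^n≤192*n*card⇒c₁*q^n≤n*card : ∀ {n q} (C : Code n q) → q ^ n ≤ 192 * n * card C → c₁ ℚ.* ℕtoℚ (q ^ n) ℚ.≤ ℕtoℚ n ℚ.* ℕtoℚ (card C)
q^n≤192*n*card⇒c₁*q^n≤n*card {n} {q} C q^n≤192nc = begin
  c₁ ℚ.* ℕtoℚ (q ^ n)                     ≤⟨ ℚₚ.*-monoˡ-≤-nonNeg c₁ (ℕtoℚ-mono-≤ q^n≤192nc) ⟩
  c₁ ℚ.* ℕtoℚ (192 * n * card C)          ≡⟨ cong (λ m → c₁ ℚ.* ℕtoℚ m) (*-assoc 192 n (card C)) ⟩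
  c₁ ℚ.* ℕtoℚ (192 * (n * card C))        ≡⟨ cong (c₁ ℚ.*_) (ℕtoℚ-*-homo 192 (n * card C)) ⟨
  c₁ ℚ.* (ℕtoℚ 192 ℚ.* ℕtoℚ (n * card C)) ≡⟨ ℚₚ.*-assoc c₁ (ℕtoℚ 192) (ℕtoℚ (n * card C)) ⟨
  (c₁ ℚ.* ℕtoℚ 192) ℚ.* ℕtoℚ (n * card C) ≡⟨ cong (ℚ._* ℕtoℚ (n * card C)) c₁*192≡1 ⟩
  1ℚ ℚ.* ℕtoℚ (n * card C)                ≡⟨ ℚₚ.*-identityˡ (ℕtoℚ (n * card C)) ⟩
  ℕtoℚ (n * card C)                       ≡⟨ ℕtoℚ-*-homo n (card C) ⟨
  ℕtoℚ n ℚ.* ℕtoℚ (card C)                ∎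
  where open ℚₚ.≤-Reasoning

n*card≤q^n-ℚ : ∀ {n q} (C : Code n q) → NonOverlapping C → ℕtoℚ n ℚ.* ℕtoℚ (card C) ℚ.≤ 1ℚ ℚ.* ℕtoℚ (q ^ n)
n*card≤q^n-ℚ {n} {q} C nonOverlapping =
  subst₂ ℚ._≤_ (sym (ℕtoℚ-*-homo n (card C))) (sym (ℚₚ.*-identityˡ (ℕtoℚ (q ^ n)))) (ℕtoℚ-mono-≤ (n*card≤q^n C nonOverlapping))

theorem10 : Σ ℚ λ c₁ → Σ ℚ λ c₂ → 0ℚ ℚ.< c₁ ×
    (∀ (n q : ℕ) → 2 ≤ n → 2 ≤ q →
    (Σ (Code n q) λ C → NonOverlapping C ×
    (c₁ ℚ.* ℕtoℚ (q ^ n) ℚ.≤ ℕtoℚ n ℚ.* ℕtoℚ (card C)))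
    × (∀ (C : Code n q) → NonOverlapping C →
    ℕtoℚ n ℚ.* ℕtoℚ (card C) ℚ.≤ c₂ ℚ.* ℕtoℚ (q ^ n)))
theorem10 =
  c₁ , 1ℚ , ℚ.*<* (ℤ.+<+ (s≤s z≤n)) ,
  λ n q 2≤n 2≤q → map₂ (λ {C} → map₂ (q^n≤192*n*card⇒c₁*q^n≤n*card {n} {q} C)) (lower-bound n q 2≤n 2≤q) , n*card≤q^n-ℚ
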